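{- Let $\lambda$ be a tableau shape with two columns and $N$ boxes in total, let $0\le j\le N$, and define the contents $\mu = 1^j 2^{N-j}$ and $\bar\mu = 1^{N-j}2^{j}$. Then $|S_i(\lambda,\mu)| = |S_i(\lambda,\bar\mu)|$ for every $i\ge 0$.
   Context: A partition $\lambda=(\lambda_1\ge \dots\ge\lambda_m>0)$ has Young diagram with $\lambda_r$ left-justified boxes in row $r$ (rows numbered top to bottom). A row-standard tableau of shape $\lambda$ is a filling of the boxes by positive integers strictly increasing from left to right along each row (no condition on columns). It has content $1^{\mu_1}2^{\mu_2}\cdots$ if exactly $\mu_k$ boxes contain $k$. Inversions: take two boxes in the same column of a row-standard tableau $\tau$ with entries $i$ and $j$. Let $i_1,i_2,\dots$ be the entries to the right of the box of $i$ in its row (read left to right) and $j_1,j_2,\dots$ those to the right of the box of $j$. Let $N'\ge 0$ be the largest integer such that $i_k,j_k$ both exist and $i_k=j_k$ for all $k\le N'$. The two boxes form an inversion pair if $i<j$ and either (a) at least one of $i_{N'+1},j_{N'+1}$ does not exist and the box of $i$ lies below the box of $j$, or (b) both exist and $i_{N'+1}>j_{N'+1}$. $n_{inv}(\tau)$ is the number of pairs of boxes forming inversion pairs, and $S_i(\lambda,\mu)$ is the set of row-standard tableaux of shape $\lambda$ and content $\mu$ with $n_{inv}=i$. -}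

module Defs where

open import Data.Nat using (ℕ; zero; suc; _+_; _∸_; _<_; _≤_; _≡ᵇ_; _<ᵇ_)
open import Data.Bool using (Bool; true; false; if_then_else_; _∧_; not)
open import Data.List using (List; []; _∷_; length; map; upTo; drop; concat)
open import Data.Nat.ListAction using (sum)
open import Data.List.Relation.Unary.All using (All)
open import Data.List.Relation.Unary.Linked using (Linked)
open import Data.Maybe using (Maybe; just; nothing)
open import Data.Product using (Σ; _×_)
open import Relation.Binary.PropositionalEquality using (_≡_)

IsPartition : List ℕ → Set
IsPartition sh = Linked (λ a b → b ≤ a) sh × All (λ a → 0 < a) sh

-- The shape has exactly two columns: λ₁ = 2.
firstPart : List ℕ → ℕ
firstPart []      = 0
firstPart (a ∷ _) = a

-- A filling of a Young diagram: list of rows (top to bottom), each row a list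
-- of entries (left to right).
Tableau : Set
Tableau = List (List ℕ)

RowStandard : List ℕ → Tableau → Set
RowStandard sh τ = (map length τ ≡ sh)
                × All (λ row → Linked _<_ row × All (λ a → 0 < a) row) τ

entries : Tableau → List ℕ
entries = concat

count : ℕ → List ℕ → ℕ
count k []       = 0
count k (a ∷ as) = if a ≡ᵇ k then suc (count k as) else count k as

-- Content μ = 1^{μ₁} 2^{μ₂} … μ_L given as the list (μ₁, …, μ_L):
-- every entry lies in {1,…,L} and exactly μ_k boxes contain k.
HasContent : List ℕ → Tableau → Set
HasContent μ τ = All (λ a → a ≤ length μ) (entries τ)
               × (map (λ k → count (suc k) (entries τ)) (upTo (length μ)) ≡ μ)

at : {A : Set} → List A → ℕ → Maybe A
at []       _       = nothing
at (x ∷ xs) zero    = just x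
at (x ∷ xs) (suc n) = at xs n

-- Given the sequences i₁,i₂,… and j₁,j₂,… to the right of the boxes of i and j,
-- and the flag "box of i lies below box of j", decide condition (a)/(b).
invTail : Bool → List ℕ → List ℕ → Bool
invTail below []       _        = below
invTail below (_ ∷ _)  []       = below
invTail below (a ∷ as) (b ∷ bs) = if a ≡ᵇ b then invTail below as bs else b <ᵇ a

-- Boxes (r , c) and (r' , c) (same column c) form an inversion pair with
-- i = τ(r,c) < j = τ(r',c).  Counting over ordered (r , r') with i < j counts
-- each unordered pair of boxes exactly once.
invAt : Tableau → ℕ → ℕ → ℕ → Bool
invAt τ r r' c with at τ r | at τ r'
... | just R | just R' with at R c | at R' c
...   | just i | just j =
        (i <ᵇ j) ∧ invTail (r' <ᵇ r) (drop (suc c) R) (drop (suc c) R')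
...   | _ | _ = false
invAt τ r r' c | _ | _ = false

b2n : Bool → ℕ
b2n true  = 1
b2n false = 0

maxRow : Tableau → ℕ
maxRow []       = 0
maxRow (R ∷ τ) with maxRow τ
... | m = if length R <ᵇ m then m else length R

ninv : Tableau → ℕ
ninv τ = sum (map (λ r → sum (map (λ r' → sum (map (λ c → b2n (invAt τ r r' c)) (upTo (maxRow τ)))) (upTo (length τ)))) (upTo (length τ)))

S : ℕ → List ℕ → List ℕ → Set
S i sh μ = Σ Tableau (λ τ → RowStandard sh τ × HasContent μ τ × ninv τ ≡ i)

-- A two-column shape is 2^a 1^b.  With entries in {1,2} every row of length 2
-- is (1,2), and the b rows of length 1, read top to bottom, spell a word w over
-- {1,2}.  No inversion involves a row (1,2) or the second column, and two boxes
-- of the first column form an inversion exactly when the lower one holds 1 and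
-- the upper one 2; so n_inv is the inversion number of w.  Reversing w and
-- exchanging 1 ↔ 2 preserves the inversion number and exchanges the contents
-- 1^j 2^(N-j) and 1^(N-j) 2^j, which gives the bijection.
module Submission where

open import Defs
open import Axiom.UniquenessOfIdentityProofs using (module Decidable⇒UIP)
open import Data.Bool using (Bool; true; false; _∧_; T)
open import Data.Bool.Properties using (∧-zeroʳ; ∧-identityʳ)
open import Data.List using (List; []; _∷_; _∷ʳ_; _++_; length; map; upTo; applyUpTo; reverse; drop; replicate; concat)
open import Data.List.Properties
  using (∷-injectiveˡ; ∷-injectiveʳ; ≡-dec; map-upTo; map-∘; map-cong; unfold-reverse; reverse-map;
         reverse-involutive; length-reverse; length-map)
open import Data.List.Relation.Unary.All as All using (All; []; _∷_)
open import Data.List.Relation.Unary.All.Properties using (++⁺; ++⁻ˡ; ++⁻ʳ; map⁺; replicate⁺; concat⁺)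
open import Data.List.Relation.Unary.Linked as Linked using (Linked; []; [-]; _∷_)
open import Data.List.Relation.Unary.Linked.Properties using (Linked⇒All)
open import Data.Maybe using (Maybe; just; nothing)
open import Data.Maybe.Relation.Unary.All as Maybe using (just; nothing)
open import Data.Nat using (ℕ; zero; suc; _+_; _∸_; _<_; _≤_; _≡ᵇ_; _<ᵇ_; z≤n; s≤s; _≟_)
open import Data.Nat.ListAction using (sum)
open import Data.Nat.Properties
  using (+-assoc; +-comm; +-identityʳ; ≤-refl; ≤-trans; <-trans; <ᵇ⇒<; ≤-irrelevant; <-irrelevant; ≡-irrelevant;
         +-commutativeSemigroup)
open import Algebra.Properties.CommutativeSemigroup +-commutativeSemigroup using (interchange)
open import Data.Product using (Σ; ∃; ∃₂; _×_; _,_)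
open import Function using (_∘_; flip)
open import Function.Bundles using (_↔_; mk↔ₛ′)
open import Relation.Nullary.Irrelevant using (Irrelevant)
open import Relation.Binary.PropositionalEquality using (_≡_; refl; sym; trans; cong; cong₂; subst; module ≡-Reasoning)
open ≡-Reasoning

∑ : ℕ → (ℕ → ℕ) → ℕ
∑ n f = sum (applyUpTo f n)

∑-upTo : ∀ n (f : ℕ → ℕ) → sum (map f (upTo n)) ≡ ∑ n f
∑-upTo n f = cong sum (map-upTo f n)

∑-cong : ∀ n {f g : ℕ → ℕ} → (∀ i → f i ≡ g i) → ∑ n f ≡ ∑ n g
∑-cong zero    f≗g = refl
∑-cong (suc n) f≗g = cong₂ _+_ (f≗g 0) (∑-cong n (f≗g ∘ suc))

∑-zero : ∀ n {f : ℕ → ℕ} → (∀ i → f i ≡ 0) → ∑ n f ≡ 0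
∑-zero zero    f≗0 = refl
∑-zero (suc n) f≗0 = cong₂ _+_ (f≗0 0) (∑-zero n (f≗0 ∘ suc))

∑-distrib-+ : ∀ n (f g : ℕ → ℕ) → ∑ n (λ i → f i + g i) ≡ ∑ n f + ∑ n g
∑-distrib-+ zero    f g = refl
∑-distrib-+ (suc n) f g = begin
  (f 0 + g 0) + ∑ n (λ i → f (suc i) + g (suc i)) ≡⟨ cong (f 0 + g 0 +_) (∑-distrib-+ n (f ∘ suc) (g ∘ suc)) ⟩
  (f 0 + g 0) + (∑ n (f ∘ suc) + ∑ n (g ∘ suc))   ≡⟨ interchange (f 0) (g 0) _ _ ⟩
  (f 0 + ∑ n (f ∘ suc)) + (g 0 + ∑ n (g ∘ suc))   ∎

∑-head : ∀ n (f : ℕ → ℕ) → 0 < n → (∀ i → f (suc i) ≡ 0) → ∑ n f ≡ f 0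
∑-head (suc n) f _ tail≗0 = trans (cong (f 0 +_) (∑-zero n tail≗0)) (+-identityʳ (f 0))

∑²-suc : ∀ n (f : ℕ → ℕ → ℕ) →
         ∑ (suc n) (λ r → ∑ (suc n) (f r))
         ≡ (f 0 0 + ∑ n (f 0 ∘ suc)) + (∑ n (λ r → f (suc r) 0) + ∑ n (λ r → ∑ n (f (suc r) ∘ suc)))
∑²-suc n f = cong (f 0 0 + ∑ n (f 0 ∘ suc) +_) (∑-distrib-+ n (λ r → f (suc r) 0) (λ r → ∑ n (f (suc r) ∘ suc)))

module _ {A : Set} where

  countᵇ : (A → Bool) → List A → ℕ
  countᵇ p []       = 0
  countᵇ p (x ∷ xs) = b2n (p x) + countᵇ p xs

  countᵇ-cong : ∀ {p q : A → Bool} → (∀ x → p x ≡ q x) → ∀ xs → countᵇ p xs ≡ countᵇ q xs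
  countᵇ-cong p≗q []       = refl
  countᵇ-cong p≗q (x ∷ xs) = cong₂ _+_ (cong b2n (p≗q x)) (countᵇ-cong p≗q xs)

  countᵇ-∷ʳ : ∀ p xs y → countᵇ p (xs ∷ʳ y) ≡ countᵇ p xs + b2n (p y)
  countᵇ-∷ʳ p []       y = +-identityʳ (b2n (p y))
  countᵇ-∷ʳ p (x ∷ xs) y =
    trans (cong (b2n (p x) +_) (countᵇ-∷ʳ p xs y)) (sym (+-assoc (b2n (p x)) _ _))

  countᵇ-reverse : ∀ p xs → countᵇ p (reverse xs) ≡ countᵇ p xs
  countᵇ-reverse p []       = refl
  countᵇ-reverse p (x ∷ xs) = begin
    countᵇ p (reverse (x ∷ xs))        ≡⟨ cong (countᵇ p) (unfold-reverse x xs) ⟩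
    countᵇ p (reverse xs ∷ʳ x)         ≡⟨ countᵇ-∷ʳ p (reverse xs) x ⟩
    countᵇ p (reverse xs) + b2n (p x)  ≡⟨ cong (_+ b2n (p x)) (countᵇ-reverse p xs) ⟩
    countᵇ p xs + b2n (p x)            ≡⟨ +-comm (countᵇ p xs) (b2n (p x)) ⟩
    countᵇ p (x ∷ xs)                  ∎

countᵇ-map : ∀ {A B : Set} (p : B → Bool) (f : A → B) xs → countᵇ p (map f xs) ≡ countᵇ (p ∘ f) xs
countᵇ-map p f []       = refl
countᵇ-map p f (x ∷ xs) = cong (b2n (p (f x)) +_) (countᵇ-map p f xs)

count≡countᵇ : ∀ k xs → count k xs ≡ countᵇ (_≡ᵇ k) xs
count≡countᵇ k []       = refl
count≡countᵇ k (x ∷ xs) with x ≡ᵇ k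
... | true  = cong suc (count≡countᵇ k xs)
... | false = count≡countᵇ k xs

module _ {A : Set} (_≺_ : A → A → Bool) where

  inversions : List A → ℕ
  inversions []      = 0
  inversions (x ∷ w) = countᵇ (_≺ x) w + inversions w

  inversions-∷ʳ : ∀ w y → inversions (w ∷ʳ y) ≡ inversions w + countᵇ (y ≺_) w
  inversions-∷ʳ []      y = refl
  inversions-∷ʳ (x ∷ w) y = begin
    countᵇ (_≺ x) (w ∷ʳ y) + inversions (w ∷ʳ y)
      ≡⟨ cong₂ _+_ (countᵇ-∷ʳ (_≺ x) w y) (inversions-∷ʳ w y) ⟩
    (countᵇ (_≺ x) w + b2n (y ≺ x)) + (inversions w + countᵇ (y ≺_) w)
      ≡⟨ interchange (countᵇ (_≺ x) w) (b2n (y ≺ x)) _ _ ⟩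
    (countᵇ (_≺ x) w + inversions w) + (b2n (y ≺ x) + countᵇ (y ≺_) w) ∎

  inversions-reverse-map : ∀ (f : A → A) → (∀ x y → (f x ≺ f y) ≡ (y ≺ x)) →
                           ∀ w → inversions (reverse (map f w)) ≡ inversions w
  inversions-reverse-map f f-reverses []      = refl
  inversions-reverse-map f f-reverses (x ∷ w) = begin
    inversions (reverse (map f (x ∷ w)))
      ≡⟨ cong inversions (unfold-reverse (f x) (map f w)) ⟩
    inversions (reverse (map f w) ∷ʳ f x)
      ≡⟨ inversions-∷ʳ (reverse (map f w)) (f x) ⟩
    inversions (reverse (map f w)) + countᵇ (f x ≺_) (reverse (map f w))
      ≡⟨ cong₂ _+_ (inversions-reverse-map f f-reverses w) (countᵇ-reverse (f x ≺_) (map f w)) ⟩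
    inversions w + countᵇ (f x ≺_) (map f w)
      ≡⟨ cong (inversions w +_) (trans (countᵇ-map (f x ≺_) f w) (countᵇ-cong (f-reverses x) w)) ⟩
    inversions w + countᵇ (_≺ x) w
      ≡⟨ +-comm (inversions w) _ ⟩
    inversions (x ∷ w) ∎

map-involutive : ∀ {A : Set} {f : A → A} → (∀ x → f (f x) ≡ x) → ∀ xs → map f (map f xs) ≡ xs
map-involutive f-involutive []       = refl
map-involutive f-involutive (x ∷ xs) = cong₂ _∷_ (f-involutive x) (map-involutive f-involutive xs)

reverse-map-involutive : ∀ {A : Set} {f : A → A} → (∀ x → f (f x) ≡ x) →
                         ∀ xs → reverse (map f (reverse (map f xs))) ≡ xs
reverse-map-involutive {f = f} f-involutive xs = begin
  reverse (map f (reverse (map f xs)))  ≡⟨ cong reverse (reverse-map f (map f xs)) ⟩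
  reverse (reverse (map f (map f xs)))  ≡⟨ reverse-involutive (map f (map f xs)) ⟩
  map f (map f xs)                      ≡⟨ map-involutive f-involutive xs ⟩
  xs                                    ∎

×-irrelevant : ∀ {A B : Set} → Irrelevant A → Irrelevant B → Irrelevant (A × B)
×-irrelevant A-irr B-irr (a , b) (a′ , b′) = cong₂ _,_ (A-irr a a′) (B-irr b b′)

Σ-↔-involution : ∀ {A : Set} {P Q : A → Set} (f : A → A) → (∀ x → f (f x) ≡ x) →
                 (∀ {x} → Irrelevant (P x)) → (∀ {x} → Irrelevant (Q x)) →
                 (∀ {x} → P x → Q (f x)) → (∀ {x} → Q x → P (f x)) →
                 Σ A P ↔ Σ A Q
Σ-↔-involution {A} f f-involutive P-irr Q-irr P⇒Q Q⇒P =
  mk↔ₛ′ (λ (x , p) → f x , P⇒Q p) (λ (x , q) → f x , Q⇒P q)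
        (λ (x , q) → back Q-irr (f-involutive x) _ q) (λ (x , p) → back P-irr (f-involutive x) _ p)
  where
  back : ∀ {R : A → Set} → (∀ {x} → Irrelevant (R x)) →
         ∀ {x y} → x ≡ y → (r : R x) (r′ : R y) → _≡_ {A = Σ A R} (x , r) (y , r′)
  back R-irr refl r r′ = cong (_ ,_) (R-irr r r′)

data Letter : Set where
  one two : Letter

value : Letter → ℕ
value one = 1
value two = 2

swap : Letter → Letter
swap one = two
swap two = one

swap-involutive : ∀ x → swap (swap x) ≡ x
swap-involutive one = refl
swap-involutive two = refl

_≺_ : Letter → Letter → Bool
x ≺ y = value x <ᵇ value y

swap-reverses-≺ : ∀ x y → (swap x ≺ swap y) ≡ (y ≺ x)
swap-reverses-≺ one one = refl
swap-reverses-≺ one two = refl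
swap-reverses-≺ two one = refl
swap-reverses-≺ two two = refl

mirror : List Letter → List Letter
mirror w = reverse (map swap w)

mirror-involutive : ∀ w → mirror (mirror w) ≡ w
mirror-involutive = reverse-map-involutive swap-involutive

length-mirror : ∀ w → length (mirror w) ≡ length w
length-mirror w = trans (length-reverse (map swap w)) (length-map swap w)

inversions-mirror : ∀ w → inversions _≺_ (mirror w) ≡ inversions _≺_ w
inversions-mirror = inversions-reverse-map _≺_ swap swap-reverses-≺

count-mirror : ∀ l w → count (value l) (map value (mirror w)) ≡ count (value (swap l)) (map value w)
count-mirror l w = begin
  count (value l) (map value (mirror w))
    ≡⟨ count≡countᵇ (value l) (map value (mirror w)) ⟩
  countᵇ (_≡ᵇ value l) (map value (reverse (map swap w)))
    ≡⟨ countᵇ-map (_≡ᵇ value l) value (mirror w) ⟩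
  countᵇ ((_≡ᵇ value l) ∘ value) (reverse (map swap w))
    ≡⟨ countᵇ-reverse _ (map swap w) ⟩
  countᵇ ((_≡ᵇ value l) ∘ value) (map swap w)
    ≡⟨ countᵇ-map _ swap w ⟩
  countᵇ ((_≡ᵇ value l) ∘ value ∘ swap) w
    ≡⟨ countᵇ-cong (value-swap l) w ⟩
  countᵇ ((_≡ᵇ value (swap l)) ∘ value) w
    ≡⟨ countᵇ-map (_≡ᵇ value (swap l)) value w ⟨
  countᵇ (_≡ᵇ value (swap l)) (map value w)
    ≡⟨ count≡countᵇ (value (swap l)) (map value w) ⟨
  count (value (swap l)) (map value w) ∎
  where
  value-swap : ∀ l x → (value (swap x) ≡ᵇ value l) ≡ (value x ≡ᵇ value (swap l))
  value-swap one one = refl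
  value-swap one two = refl
  value-swap two one = refl
  value-swap two two = refl

twoColumnShape : ℕ → ℕ → List ℕ
twoColumnShape a b = replicate a 2 ++ replicate b 1

singleRow : Letter → List ℕ
singleRow x = value x ∷ []

tableau : ℕ → List Letter → Tableau
tableau a w = replicate a (1 ∷ 2 ∷ []) ++ map singleRow w

twoColumnShape-bounded : ∀ {sh} → Linked (λ a b → b ≤ a) sh → All (λ a → 0 < a) sh → All (_≤ 2) sh →
                         ∃₂ λ a b → sh ≡ twoColumnShape a b
twoColumnShape-bounded {[]} _ _ _ = 0 , 0 , refl
twoColumnShape-bounded {0 ∷ _} _ (() ∷ _) _
twoColumnShape-bounded {1 ∷ _} desc (_ ∷ pos) (_ ∷ bd) with twoColumnShape-bounded (Linked.tail desc) pos bd
... | zero , b , refl = 0 , suc b , refl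
twoColumnShape-bounded {1 ∷ _} (s≤s () ∷ _) _ _ | suc a , b , refl
twoColumnShape-bounded {2 ∷ _} desc (_ ∷ pos) (_ ∷ bd) with twoColumnShape-bounded (Linked.tail desc) pos bd
... | a , b , refl = suc a , b , refl
twoColumnShape-bounded {suc (suc (suc _)) ∷ _} _ _ (s≤s (s≤s ()) ∷ _)

twoColumnShape-of : ∀ sh → IsPartition sh → firstPart sh ≡ 2 → ∃₂ λ a b → sh ≡ twoColumnShape a b
twoColumnShape-of (_ ∷ _) (desc , pos) refl = twoColumnShape-bounded desc pos (Linked⇒All (flip ≤-trans) ≤-refl desc)

RowIncreasing : List ℕ → Set
RowIncreasing row = Linked _<_ row × All (λ a → 0 < a) row

fullRow : ∀ {R} → length R ≡ 2 → RowIncreasing R → All (_≤ 2) R → R ≡ 1 ∷ 2 ∷ []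
fullRow {_ ∷ _ ∷ []} refl (s≤s (s≤s z≤n) ∷ [-] , s≤s z≤n ∷ _) (_ ∷ s≤s (s≤s z≤n) ∷ []) = refl

singleRow-of : ∀ {R} → length R ≡ 1 → All (λ a → 0 < a) R → All (_≤ 2) R → ∃ λ x → R ≡ singleRow x
singleRow-of {0 ∷ []} refl (() ∷ []) _
singleRow-of {1 ∷ []} refl _ _ = one , refl
singleRow-of {2 ∷ []} refl _ _ = two , refl
singleRow-of {suc (suc (suc _)) ∷ []} refl _ (s≤s (s≤s ()) ∷ [])

normalForm : ∀ a b τ → RowStandard (twoColumnShape a b) τ → All (_≤ 2) (entries τ) →
             ∃ λ w → τ ≡ tableau a w × length w ≡ b
normalForm zero zero [] _ _ = [] , refl , refl
normalForm zero zero (_ ∷ _) (() , _) _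
normalForm zero (suc b) [] (() , _) _
normalForm zero (suc b) (R ∷ τ) (len , (_ , pos) ∷ rows) bd
  with singleRow-of (∷-injectiveˡ len) pos (++⁻ˡ R bd)
     | normalForm zero b τ (∷-injectiveʳ len , rows) (++⁻ʳ R bd)
... | x , refl | w , refl , refl = x ∷ w , refl , refl
normalForm (suc a) b [] (() , _) _
normalForm (suc a) b (R ∷ τ) (len , row ∷ rows) bd
  with fullRow (∷-injectiveˡ len) row (++⁻ˡ R bd) | normalForm a b τ (∷-injectiveʳ len , rows) (++⁻ʳ R bd)
... | refl | w , refl , refl = w , refl , refl

data TwoColumnRow : List ℕ → Set where
  full   : TwoColumnRow (1 ∷ 2 ∷ [])
  single : ∀ x → TwoColumnRow (singleRow x)

twoColumnRow-increasing : ∀ {R} → TwoColumnRow R → RowIncreasing R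
twoColumnRow-increasing full = s≤s (s≤s z≤n) ∷ [-] , s≤s z≤n ∷ s≤s z≤n ∷ []
twoColumnRow-increasing (single one) = [-] , s≤s z≤n ∷ []
twoColumnRow-increasing (single two) = [-] , s≤s z≤n ∷ []

twoColumnRow-bounded : ∀ {R} → TwoColumnRow R → All (_≤ 2) R
twoColumnRow-bounded full         = s≤s z≤n ∷ ≤-refl ∷ []
twoColumnRow-bounded (single one) = s≤s z≤n ∷ []
twoColumnRow-bounded (single two) = ≤-refl ∷ []

twoColumnRow-nonempty : ∀ {R} → TwoColumnRow R → 0 < length R
twoColumnRow-nonempty full       = s≤s z≤n
twoColumnRow-nonempty (single _) = s≤s z≤n

rows-tableau : ∀ a w → All TwoColumnRow (tableau a w)
rows-tableau a w = ++⁺ (replicate⁺ a full) (map⁺ (All.universal single w))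

map-length-tableau : ∀ a w → map length (tableau a w) ≡ twoColumnShape a (length w)
map-length-tableau (suc a) w       = cong (2 ∷_) (map-length-tableau a w)
map-length-tableau zero    []      = refl
map-length-tableau zero    (x ∷ w) = cong (1 ∷_) (map-length-tableau zero w)

rowStandard-tableau : ∀ a w → RowStandard (twoColumnShape a (length w)) (tableau a w)
rowStandard-tableau a w = map-length-tableau a w , All.map twoColumnRow-increasing (rows-tableau a w)

entries-tableau-bounded : ∀ a w → All (_≤ 2) (entries (tableau a w))
entries-tableau-bounded a w = concat⁺ (All.map twoColumnRow-bounded (rows-tableau a w))

count-tableau : ∀ l a w → count (value l) (entries (tableau a w)) ≡ a + count (value l) (map value w)
count-tableau one (suc a) w = cong suc (count-tableau one a w)
count-tableau two (suc a) w = cong suc (count-tableau two a w)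
count-tableau l   zero    w = cong (count (value l)) (concat-singleRows w)
  where
  concat-singleRows : ∀ w → concat (map singleRow w) ≡ map value w
  concat-singleRows []      = refl
  concat-singleRows (x ∷ w) = cong (value x ∷_) (concat-singleRows w)

at-All : ∀ {A : Set} {P : A → Set} {xs} → All P xs → ∀ r → Maybe.All P (at xs r)
at-All []       r       = nothing
at-All (p ∷ ps) zero    = just p
at-All (p ∷ ps) (suc r) = at-All ps r

-- invAt with the two rows as arguments, so that it can be evaluated on a view of the rows.
invRows : Maybe (List ℕ) → Maybe (List ℕ) → Bool → ℕ → Bool
invRows (just R) (just R′) below c with at R c | at R′ c
... | just i | just j = (i <ᵇ j) ∧ invTail below (drop (suc c) R) (drop (suc c) R′)
... | _      | _      = false
invRows _ _ _ _ = false

invAt≡invRows : ∀ τ r r′ c → invAt τ r r′ c ≡ invRows (at τ r) (at τ r′) (r′ <ᵇ r) c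
invAt≡invRows τ r r′ c with at τ r | at τ r′
... | nothing | _       = refl
... | just _  | nothing = refl
... | just R  | just R′ with at R c | at R′ c
...   | nothing | _       = refl
...   | just _  | nothing = refl
...   | just _  | just _  = refl

invRows-secondColumn : ∀ {m m′} → Maybe.All TwoColumnRow m → Maybe.All TwoColumnRow m′ →
                       ∀ below c → invRows m m′ below (suc c) ≡ false
invRows-secondColumn nothing                _                      below c       = refl
invRows-secondColumn (just _)               nothing                below c       = refl
invRows-secondColumn (just full)            (just full)            below zero    = refl
invRows-secondColumn (just full)            (just full)            below (suc c) = refl
invRows-secondColumn (just full)            (just (single _))      below zero    = refl
invRows-secondColumn (just full)            (just (single _))      below (suc c) = refl
invRows-secondColumn (just (single _))      (just _)               below c       = refl

-- With the box of i above the box of j, condition (a) fails, and (b) needs two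
-- rows (1,2), where i = j.
invRows-upper : ∀ {R m} → TwoColumnRow R → Maybe.All TwoColumnRow m → invRows (just R) m false 0 ≡ false
invRows-upper _          nothing           = refl
invRows-upper full       (just full)       = refl
invRows-upper full       (just (single _)) = ∧-zeroʳ _
invRows-upper (single _) (just full)       = ∧-zeroʳ _
invRows-upper (single _) (just (single _)) = ∧-zeroʳ _

invRows-fullAbove : ∀ {m} → Maybe.All TwoColumnRow m → invRows m (just (1 ∷ 2 ∷ [])) true 0 ≡ false
invRows-fullAbove nothing             = refl
invRows-fullAbove (just full)         = refl
invRows-fullAbove (just (single one)) = refl
invRows-fullAbove (just (single two)) = refl

inv₀ : Tableau → ℕ → ℕ → ℕ
inv₀ τ r r′ = b2n (invRows (at τ r) (at τ r′) (r′ <ᵇ r) 0)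

ninv₀ : Tableau → ℕ
ninv₀ τ = ∑ (length τ) λ r → ∑ (length τ) λ r′ → inv₀ τ r r′

maxRow-positive : ∀ R τ → 0 < length R → 0 < maxRow (R ∷ τ)
maxRow-positive R τ 0<R with maxRow τ
... | m with length R <ᵇ m in R<m
...   | true  = <-trans 0<R (<ᵇ⇒< (length R) m (subst T (sym R<m) _))
...   | false = 0<R

ninv≡ninv₀ : ∀ {τ} → All TwoColumnRow τ → ninv τ ≡ ninv₀ τ
ninv≡ninv₀ {[]}    []                = refl
ninv≡ninv₀ {R ∷ τ} rows@(row ∷ _) = begin
  ninv (R ∷ τ)
    ≡⟨ ∑-upTo L (λ r → sum (map (λ r′ → sum (map (inv r r′) (upTo M))) (upTo L))) ⟩
  ∑ L (λ r → sum (map (λ r′ → sum (map (inv r r′) (upTo M))) (upTo L)))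
    ≡⟨ ∑-cong L (λ r → trans (∑-upTo L (λ r′ → sum (map (inv r r′) (upTo M))))
                             (∑-cong L λ r′ → ∑-upTo M (inv r r′))) ⟩
  ∑ L (λ r → ∑ L (λ r′ → ∑ M (inv r r′)))
    ≡⟨ ∑-cong L (λ r → ∑-cong L λ r′ →
         ∑-head M (inv r r′) (maxRow-positive R τ (twoColumnRow-nonempty row)) (secondColumn r r′)) ⟩
  ∑ L (λ r → ∑ L (λ r′ → inv r r′ 0))
    ≡⟨ ∑-cong L (λ r → ∑-cong L λ r′ → cong b2n (invAt≡invRows (R ∷ τ) r r′ 0)) ⟩
  ninv₀ (R ∷ τ) ∎
  where
  L = length (R ∷ τ)
  M = maxRow (R ∷ τ)
  inv : ℕ → ℕ → ℕ → ℕ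
  inv r r′ c = b2n (invAt (R ∷ τ) r r′ c)
  secondColumn : ∀ r r′ c → inv r r′ (suc c) ≡ 0
  secondColumn r r′ c = cong b2n (trans (invAt≡invRows (R ∷ τ) r r′ (suc c))
                                        (invRows-secondColumn (at-All rows r) (at-All rows r′) _ c))

ninv₀-singleRows : ∀ w → ninv₀ (map singleRow w) ≡ inversions _≺_ w
ninv₀-singleRows []      = refl
ninv₀-singleRows (x ∷ w) = begin
  ninv₀ (singleRow x ∷ ρ)
    ≡⟨ ∑²-suc n (inv₀ (singleRow x ∷ ρ)) ⟩
  (inv₀ (singleRow x ∷ ρ) 0 0 + ∑ n (λ r′ → inv₀ (singleRow x ∷ ρ) 0 (suc r′)))
    + (∑ n (λ r → inv₀ (singleRow x ∷ ρ) (suc r) 0) + ninv₀ ρ)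
    ≡⟨ cong₂ _+_ (cong₂ _+_ (cong b2n (invRows-upper (single x) (just (single x))))
                            (∑-zero n λ r′ → cong b2n (invRows-upper (single x) (at-All rows r′))))
                 (cong₂ _+_ (lowerInversions w) (ninv₀-singleRows w)) ⟩
  inversions _≺_ (x ∷ w) ∎
  where
  ρ = map singleRow w
  n = length ρ
  rows = rows-tableau 0 w
  lowerInversions : ∀ w → ∑ (length (map singleRow w)) (λ r → inv₀ (singleRow x ∷ map singleRow w) (suc r) 0)
                          ≡ countᵇ (_≺ x) w
  lowerInversions []      = refl
  lowerInversions (y ∷ w) = cong₂ _+_ (cong b2n (∧-identityʳ (y ≺ x))) (lowerInversions w)

ninv₀-tableau : ∀ a w → ninv₀ (tableau a w) ≡ inversions _≺_ w
ninv₀-tableau zero    w = ninv₀-singleRows w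
ninv₀-tableau (suc a) w = begin
  ninv₀ ((1 ∷ 2 ∷ []) ∷ τ)
    ≡⟨ ∑²-suc n (inv₀ ((1 ∷ 2 ∷ []) ∷ τ)) ⟩
  (0 + ∑ n (λ r′ → inv₀ ((1 ∷ 2 ∷ []) ∷ τ) 0 (suc r′)))
    + (∑ n (λ r → inv₀ ((1 ∷ 2 ∷ []) ∷ τ) (suc r) 0) + ninv₀ τ)
    ≡⟨ cong₂ _+_ (∑-zero n λ r′ → cong b2n (invRows-upper full (at-All rows r′)))
                 (cong₂ _+_ (∑-zero n λ r → cong b2n (invRows-fullAbove (at-All rows r)))
                            (ninv₀-tableau a w)) ⟩
  inversions _≺_ w ∎
  where
  τ = tableau a w
  n = length τ
  rows = rows-tableau a w

ninv-tableau : ∀ a w → ninv (tableau a w) ≡ inversions _≺_ w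
ninv-tableau a w = trans (ninv≡ninv₀ (rows-tableau a w)) (ninv₀-tableau a w)

swapEntry : ℕ → ℕ
swapEntry 1 = 2
swapEntry 2 = 1
swapEntry n = n

swapEntry-involutive : ∀ n → swapEntry (swapEntry n) ≡ n
swapEntry-involutive 0                   = refl
swapEntry-involutive 1                   = refl
swapEntry-involutive 2                   = refl
swapEntry-involutive (suc (suc (suc n))) = refl

-- Defined on all tableaux, so that it is an involution outright.
dual : ℕ → Tableau → Tableau
dual zero    τ       = reverse (map (map swapEntry) τ)
dual (suc a) []      = []
dual (suc a) (R ∷ τ) = R ∷ dual a τ

dual-involutive : ∀ a τ → dual a (dual a τ) ≡ τ
dual-involutive zero    τ       = reverse-map-involutive (map-involutive swapEntry-involutive) τ
dual-involutive (suc a) []      = refl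
dual-involutive (suc a) (R ∷ τ) = cong (R ∷_) (dual-involutive a τ)

dual-tableau : ∀ a w → dual a (tableau a w) ≡ tableau a (mirror w)
dual-tableau (suc a) w = cong ((1 ∷ 2 ∷ []) ∷_) (dual-tableau a w)
dual-tableau zero    w = begin
  reverse (map (map swapEntry) (map singleRow w))  ≡⟨ cong reverse (map-∘ w) ⟨
  reverse (map (map swapEntry ∘ singleRow) w)      ≡⟨ cong reverse (map-cong swap-singleRow w) ⟩
  reverse (map (singleRow ∘ swap) w)               ≡⟨ cong reverse (map-∘ w) ⟩
  reverse (map singleRow (map swap w))             ≡⟨ reverse-map singleRow (map swap w) ⟨
  map singleRow (mirror w)                         ∎
  where
  swap-singleRow : ∀ x → map swapEntry (singleRow x) ≡ singleRow (swap x)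
  swap-singleRow one = refl
  swap-singleRow two = refl

InS : ℕ → List ℕ → List ℕ → Tableau → Set
InS i sh μ τ = RowStandard sh τ × HasContent μ τ × ninv τ ≡ i

InS-irrelevant : ∀ i sh μ τ → Irrelevant (InS i sh μ τ)
InS-irrelevant i sh μ τ =
  ×-irrelevant (×-irrelevant List-≡-irrelevant
                             (All.irrelevant (×-irrelevant (Linked.irrelevant <-irrelevant) (All.irrelevant <-irrelevant))))
    (×-irrelevant (×-irrelevant (All.irrelevant ≤-irrelevant) List-≡-irrelevant) ≡-irrelevant)
  where
  List-≡-irrelevant : ∀ {xs ys : List ℕ} → Irrelevant (xs ≡ ys)
  List-≡-irrelevant = Decidable⇒UIP.≡-irrelevant (≡-dec _≟_)

dual-InS : ∀ a b c₁ c₂ i {τ} → InS i (twoColumnShape a b) (c₁ ∷ c₂ ∷ []) τ →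
           InS i (twoColumnShape a b) (c₂ ∷ c₁ ∷ []) (dual a τ)
dual-InS a b c₁ c₂ i (standard , (bounded , content) , ninv≡i) with normalForm a b _ standard bounded
... | w , refl , refl rewrite dual-tableau a w =
  ( subst (λ b → RowStandard (twoColumnShape a b) (tableau a (mirror w))) (length-mirror w)
          (rowStandard-tableau a (mirror w))
  , ( entries-tableau-bounded a (mirror w)
    , cong₂ (λ m n → m ∷ n ∷ [])
            (trans (count-dual one) (∷-injectiveˡ (∷-injectiveʳ content)))
            (trans (count-dual two) (∷-injectiveˡ content)) )
  , trans (ninv-tableau a (mirror w)) (trans (inversions-mirror w) (trans (sym (ninv-tableau a w)) ninv≡i)) )
  where
  count-dual : ∀ l → count (value l) (entries (tableau a (mirror w))) ≡ count (value (swap l)) (entries (tableau a w))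
  count-dual l = begin
    count (value l) (entries (tableau a (mirror w)))  ≡⟨ count-tableau l a (mirror w) ⟩
    a + count (value l) (map value (mirror w))        ≡⟨ cong (a +_) (count-mirror l w) ⟩
    a + count (value (swap l)) (map value w)          ≡⟨ count-tableau (swap l) a w ⟨
    count (value (swap l)) (entries (tableau a w))    ∎

lemma2p6 : (sh : List ℕ) → IsPartition sh → firstPart sh ≡ 2 →
           (j : ℕ) → j ≤ sum sh → (i : ℕ) →
           S i sh (j ∷ (sum sh ∸ j) ∷ []) ↔ S i sh ((sum sh ∸ j) ∷ j ∷ [])
lemma2p6 sh partition twoColumns j _ i with twoColumnShape-of sh partition twoColumns
... | a , b , refl =
  Σ-↔-involution (dual a) (dual-involutive a)
    (InS-irrelevant i _ _ _) (InS-irrelevant i _ _ _)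
    (dual-InS a b j (sum sh ∸ j) i) (dual-InS a b (sum sh ∸ j) j i)
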